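{- For every $d\ge 1$ there exists $u\in\mathbb{R}^d\setminus\{0\}$ such that the hyperplane $u^\perp=\{x\mid\langle u,x\rangle=0\}$ contains no vertex of $C_d=[-1,1]^d$ and the $(d-1)$-dimensional polytope $C_d\cap u^\perp$ has exactly $\left\lceil \tfrac{d}{2}\right\rceil\binom{d}{\lceil d/2\rceil}$ vertices.
   Context: It is known (O'Neil) that $\left\lceil \tfrac{d}{2}\right\rceil\binom{d}{\lceil d/2\rceil}$ is an upper bound on the number of vertices of any $(d-1)$-dimensional polytope $C_d\cap H$ with $H$ an affine hyperplane; the theorem states this bound is attained by a hyperplane through the origin containing no vertex of the cube.
   Formalization: The vector u and the points of $C_d\cap u^\perp$ are taken in ℚ^d instead of ℝ^d, so vertices are extreme points among points with rational coordinates. -}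

module Defs where

open import Data.Nat using (ℕ; zero; suc)
open import Data.Fin using (Fin; zero; suc)
open import Data.Rational using (ℚ; 0ℚ; 1ℚ; _+_; _*_; _-_; -_; _≤_; _<_)
open import Data.Product using (Σ; _×_)
open import Data.Sum using (_⊎_)
open import Relation.Binary.PropositionalEquality using (_≡_)
open import Relation.Nullary using (¬_)

Point : ℕ → Set
Point d = Fin d → ℚ

-- Pointwise equality of points (avoids function extensionality).
_≐_ : ∀ {d} → Point d → Point d → Set
x ≐ y = ∀ i → x i ≡ y i

dot : ∀ {d} → Point d → Point d → ℚ
dot {zero}  u x = 0ℚ
dot {suc d} u x = u zero * x zero + dot (λ i → u (suc i)) (λ i → x (suc i))

InCube : ∀ {d} → Point d → Set
InCube x = ∀ i → (- 1ℚ ≤ x i) × (x i ≤ 1ℚ)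

CubeVertex : ∀ {d} → Point d → Set
CubeVertex v = ∀ i → (v i ≡ 1ℚ) ⊎ (v i ≡ - 1ℚ)

Section : ∀ {d} → Point d → Point d → Set
Section u x = InCube x × (dot u x ≡ 0ℚ)

IsVertex : ∀ {d} → (Point d → Set) → Point d → Set
IsVertex {d} S x =
  S x ×
  ((y z : Point d) (t : ℚ) → S y → S z → 0ℚ < t → t < 1ℚ →
     x ≐ (λ i → t * y i + (1ℚ - t) * z i) → y ≐ z)

HasExactlyVertices : ∀ {d} → (Point d → Set) → ℕ → Set
HasExactlyVertices {d} S n =
  Σ (Fin n → Point d) λ w →
    ((k : Fin n) → IsVertex S (w k)) ×
    ((k l : Fin n) → w k ≐ w l → k ≡ l) ×
    ((x : Point d) → IsVertex S x → Σ (Fin n) λ k → x ≐ w k)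

{-# OPTIONS --safe #-}
-- For odd d = 2k+1 take u = (1,…,1). A sum of an odd number of ±1 is never 0, so u⊥ misses
-- every vertex of the cube. At a vertex x of the section at most one coordinate lies strictly
-- inside (-1,1): two such coordinates could be moved in opposite directions within the section.
-- The other coordinates are ±1 and their sum is an integer, so the free coordinate is 0 and the
-- signs are balanced; conversely every such point is a vertex. The vertices are therefore the
-- d·C(2k,k) = ⌈d/2⌉·C(d,⌈d/2⌉) sign vectors with one zero and k signs of each kind.
-- For even d = 2k+2 take u = (0,1,…,1): the first coordinate has weight 0 and must be ±1 at a
-- vertex, while the others form a vertex of the odd case, which doubles the count.
module Submission where

open import Defs
open import Data.Fin using (Fin; zero; suc)
open import Data.Vec.Functional using (tail)
open import Data.Product using (Σ; ∃; _×_; _,_; proj₁; proj₂; map₁; map₂)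
open import Data.Sum using (_⊎_; inj₁; inj₂)
open import Function using (_∘_)
open import Relation.Binary.PropositionalEquality using (_≡_; _≢_; refl; sym; trans; cong; cong₂; subst; subst₂; module ≡-Reasoning)
open import Relation.Nullary using (¬_; yes; no)

module SignVectors where
  open import Data.Nat using (ℕ; zero; suc; _+_; _*_; _∸_; ⌊_/2⌋; ⌈_/2⌉)
  open import Data.Nat.Properties using (+-suc; +-assoc; +-comm; +-identityʳ; *-zeroʳ; *-identityʳ; *-distribˡ-+; suc-injective; *-distribʳ-+; +-cancelˡ-≡; n≡⌊n+n/2⌋; n≡⌈n+n/2⌉; m≤n+m; m+n∸n≡m; even≢odd)
  open import Data.Nat.Combinatorics using (_C_; nCk+nC[k+1]≡[n+1]C[k+1]; nC1≡n; nCk≡nC[n∸k])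
  open import Data.Vec using (Vec; []; _∷_; head)
  open import Data.Vec.Properties using (∷-injectiveʳ)
  open import Data.List using (List; []; _∷_; [_]; _++_; map; length)
  open import Data.List.Properties using (length-map; length-++)
  open import Data.List.Membership.Propositional using (_∈_)
  open import Data.List.Membership.Propositional.Properties using (∈-map⁺; ∈-map⁻; ∈-++⁺ˡ; ∈-++⁺ʳ; ∈-++⁻)
  open import Data.List.Relation.Unary.Any using (here)
  import Data.List.Relation.Unary.All as All
  open import Data.List.Relation.Unary.Unique.Propositional using (Unique; []; _∷_)
  import Data.List.Relation.Unary.Unique.Propositional.Properties as Unique
  open import Data.List.Relation.Binary.Disjoint.Propositional using (Disjoint)
  open ≡-Reasoning

  private variable
    n j k : ℕ

  data Sign : Set where
    P M Z : Sign

  #P #M #Z : Vec Sign n → ℕ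
  #P []      = 0
  #P (P ∷ c) = suc (#P c)
  #P (_ ∷ c) = #P c
  #M []      = 0
  #M (M ∷ c) = suc (#M c)
  #M (_ ∷ c) = #M c
  #Z []      = 0
  #Z (Z ∷ c) = suc (#Z c)
  #Z (_ ∷ c) = #Z c

  #P+#M+#Z : (c : Vec Sign n) → #P c + #M c + #Z c ≡ n
  #P+#M+#Z []      = refl
  #P+#M+#Z (P ∷ c) = cong suc (#P+#M+#Z c)
  #P+#M+#Z (M ∷ c) = trans (cong (_+ #Z c) (+-suc (#P c) (#M c))) (cong suc (#P+#M+#Z c))
  #P+#M+#Z (Z ∷ c) = trans (+-suc (#P c + #M c) (#Z c)) (cong suc (#P+#M+#Z c))

  odd≢double : ∀ k m → suc (k + k) ≢ m + m
  odd≢double k m eq = even≢odd m k (begin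
    m + (m + 0)    ≡⟨ cong (m +_) (+-identityʳ m) ⟩
    m + m          ≡⟨ sym eq ⟩
    suc (k + k)    ≡⟨ cong (λ l → suc (k + l)) (sym (+-identityʳ k)) ⟩
    suc (k + (k + 0)) ∎)

  double-injective : ∀ m k → m + m ≡ k + k → m ≡ k
  double-injective m k eq = trans (n≡⌊n+n/2⌋ m) (trans (cong ⌊_/2⌋ eq) (sym (n≡⌊n+n/2⌋ k)))

  balanced⇒#P≡k : (c : Vec Sign (suc (k + k))) → #Z c ≡ 1 → #P c ≡ #M c → #P c ≡ k
  balanced⇒#P≡k {k} c z≡1 p≡m = double-injective (#P c) k (suc-injective (begin
    suc (#P c + #P c)   ≡⟨ +-comm 1 (#P c + #P c) ⟩
    #P c + #P c + 1     ≡⟨ cong₂ (λ a b → #P c + a + b) p≡m (sym z≡1) ⟩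
    #P c + #M c + #Z c  ≡⟨ #P+#M+#Z c ⟩
    suc (k + k)         ∎))

  #P≡k⇒#M≡k : (c : Vec Sign (suc (k + k))) → #Z c ≡ 1 → #P c ≡ k → #M c ≡ k
  #P≡k⇒#M≡k {k} c z≡1 p≡k = +-cancelˡ-≡ k (#M c) k (suc-injective (begin
    suc (k + #M c)      ≡⟨ +-comm 1 (k + #M c) ⟩
    k + #M c + 1        ≡⟨ cong₂ (λ a b → a + #M c + b) (sym p≡k) (sym z≡1) ⟩
    #P c + #M c + #Z c  ≡⟨ #P+#M+#Z c ⟩
    suc (k + k)         ∎))

  #Z≡0⇒unbalanced : (c : Vec Sign (suc (k + k))) → #Z c ≡ 0 → #P c ≢ #M c
  #Z≡0⇒unbalanced {k} c z≡0 p≡m = odd≢double k (#P c) (sym (begin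
    #P c + #P c         ≡⟨ cong (#P c +_) p≡m ⟩
    #P c + #M c         ≡⟨ sym (+-identityʳ _) ⟩
    #P c + #M c + 0     ≡⟨ cong (#P c + #M c +_) (sym z≡0) ⟩
    #P c + #M c + #Z c  ≡⟨ #P+#M+#Z c ⟩
    suc (k + k)         ∎))

  -- If F j lists vectors with j plus signs, extend F j lists vectors of one more coordinate with j plus signs.
  extend : (ℕ → List (Vec Sign n)) → ℕ → List (Vec Sign (suc n))
  extend F zero    = map (M ∷_) (F zero)
  extend F (suc j) = map (P ∷_) (F j) ++ map (M ∷_) (F (suc j))

  length-extend : (F : ℕ → List (Vec Sign n)) (j : ℕ) →
                  length (extend F (suc j)) ≡ length (F j) + length (F (suc j))
  length-extend F j = trans (length-++ (map (P ∷_) (F j)))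
                            (cong₂ _+_ (length-map (P ∷_) (F j)) (length-map (M ∷_) (F (suc j))))

  module _ (F : ℕ → List (Vec Sign n)) where

    ∈-extend-P : ∀ {j c} → c ∈ F j → P ∷ c ∈ extend F (suc j)
    ∈-extend-P = ∈-++⁺ˡ ∘ ∈-map⁺ (P ∷_)

    ∈-extend-M : ∀ {j c} → c ∈ F j → M ∷ c ∈ extend F j
    ∈-extend-M {zero}  = ∈-map⁺ (M ∷_)
    ∈-extend-M {suc j} = ∈-++⁺ʳ (map (P ∷_) (F j)) ∘ ∈-map⁺ (M ∷_)

    extend-elim : (Q : ℕ → Vec Sign (suc n) → Set) →
                  (∀ {j c} → c ∈ F j → Q (suc j) (P ∷ c)) → (∀ {j c} → c ∈ F j → Q j (M ∷ c)) →
                  ∀ {j c} → c ∈ extend F j → Q j c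
    extend-elim Q QP QM {zero} c∈ with ∈-map⁻ (M ∷_) c∈
    ... | _ , c′∈ , refl = QM c′∈
    extend-elim Q QP QM {suc j} c∈ with ∈-++⁻ (map (P ∷_) (F j)) c∈
    ... | inj₁ c∈P with ∈-map⁻ (P ∷_) c∈P
    ...   | _ , c′∈ , refl = QP c′∈
    extend-elim Q QP QM {suc j} c∈ | inj₂ c∈M with ∈-map⁻ (M ∷_) c∈M
    ...   | _ , c′∈ , refl = QM c′∈

    extend-unique : (∀ j → Unique (F j)) → ∀ j → Unique (extend F j)
    extend-unique u zero    = Unique.map⁺ ∷-injectiveʳ (u zero)
    extend-unique u (suc j) = Unique.++⁺ (Unique.map⁺ ∷-injectiveʳ (u j)) (Unique.map⁺ ∷-injectiveʳ (u (suc j))) P∷-disjoint-M∷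
      where
      P∷-disjoint-M∷ : Disjoint (map (P ∷_) (F j)) (map (M ∷_) (F (suc j)))
      P∷-disjoint-M∷ (c∈P , c∈M) with ∈-map⁻ (P ∷_) c∈P | ∈-map⁻ (M ∷_) c∈M
      ... | _ , _ , refl | _ , _ , ()

    Z∷-disjoint-extend : ∀ {j} {xs : List (Vec Sign n)} → Disjoint (map (Z ∷_) xs) (extend F j)
    Z∷-disjoint-extend {j} (c∈Z , c∈) with ∈-map⁻ (Z ∷_) c∈Z
    ... | _ , _ , refl = extend-elim (λ _ c → head c ≢ Z) (λ _ ()) (λ _ ()) {j} c∈ refl

  -- The vectors with j plus signs and no Z, resp. exactly one Z (see ∈-codes⁻ and ∈-codes₀⁻).
  codes : (n j : ℕ) → List (Vec Sign n)
  codes zero    zero    = [ [] ]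
  codes zero    (suc j) = []
  codes (suc n)         = extend (codes n)

  codes₀ : (n j : ℕ) → List (Vec Sign n)
  codes₀ zero    j = []
  codes₀ (suc n) j = map (Z ∷_) (codes n j) ++ extend (codes₀ n) j

  length-codes : ∀ n j → length (codes n j) ≡ n C j
  length-codes zero    zero    = refl
  length-codes zero    (suc j) = refl
  length-codes (suc n) zero    = trans (length-map (M ∷_) (codes n 0)) (length-codes n 0)
  length-codes (suc n) (suc j) = begin
    length (extend (codes n) (suc j))              ≡⟨ length-extend (codes n) j ⟩
    length (codes n j) + length (codes n (suc j))  ≡⟨ cong₂ _+_ (length-codes n j) (length-codes n (suc j)) ⟩
    n C j + n C suc j                              ≡⟨ nCk+nC[k+1]≡[n+1]C[k+1] n j ⟩
    suc n C suc j                                  ∎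

  length-codes₀ : ∀ n j → length (codes₀ (suc n) j) ≡ suc n * (n C j)
  length-codes₀ n j = trans (length-++ (map (Z ∷_) (codes n j)))
                            (cong₂ _+_ (trans (length-map (Z ∷_) (codes n j)) (length-codes n j)) (length-extend₀ n j))
    where
    length-extend₀ : ∀ n j → length (extend (codes₀ n) j) ≡ n * (n C j)
    length-extend₀ zero    zero    = refl
    length-extend₀ zero    (suc j) = refl
    length-extend₀ (suc n) zero    = trans (length-map (M ∷_) (codes₀ (suc n) 0)) (length-codes₀ n 0)
    length-extend₀ (suc n) (suc j) = begin
      length (extend (codes₀ (suc n)) (suc j))                 ≡⟨ length-extend (codes₀ (suc n)) j ⟩
      length (codes₀ (suc n) j) + length (codes₀ (suc n) (suc j)) ≡⟨ cong₂ _+_ (length-codes₀ n j) (length-codes₀ n (suc j)) ⟩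
      suc n * (n C j) + suc n * (n C suc j)                    ≡⟨ sym (*-distribˡ-+ (suc n) (n C j) (n C suc j)) ⟩
      suc n * (n C j + n C suc j)                              ≡⟨ cong (suc n *_) (nCk+nC[k+1]≡[n+1]C[k+1] n j) ⟩
      suc n * (suc n C suc j)                                  ∎

  codes-unique : ∀ n j → Unique (codes n j)
  codes-unique zero    zero    = All.[] ∷ []
  codes-unique zero    (suc j) = []
  codes-unique (suc n)         = extend-unique (codes n) (codes-unique n)

  codes₀-unique : ∀ n j → Unique (codes₀ n j)
  codes₀-unique zero    j = []
  codes₀-unique (suc n) j =
    Unique.++⁺ (Unique.map⁺ ∷-injectiveʳ (codes-unique n j)) (extend-unique (codes₀ n) (codes₀-unique n) j) (Z∷-disjoint-extend (codes₀ n) {j})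

  ∈-codes⁻ : ∀ {c : Vec Sign n} → c ∈ codes n j → #Z c ≡ 0 × #P c ≡ j
  ∈-codes⁻ {zero} {zero} (here refl) = refl , refl
  ∈-codes⁻ {suc n} = extend-elim (codes n) (λ j c → #Z c ≡ 0 × #P c ≡ j) (map₂ (cong suc) ∘ ∈-codes⁻) ∈-codes⁻

  ∈-codes⁺ : (c : Vec Sign n) → #Z c ≡ 0 → c ∈ codes n (#P c)
  ∈-codes⁺ []      _   = here refl
  ∈-codes⁺ {suc n} (P ∷ c) z≡0 = ∈-extend-P (codes n) (∈-codes⁺ c z≡0)
  ∈-codes⁺ {suc n} (M ∷ c) z≡0 = ∈-extend-M (codes n) (∈-codes⁺ c z≡0)

  ∈-codes₀⁻ : ∀ {c : Vec Sign n} → c ∈ codes₀ n j → #Z c ≡ 1 × #P c ≡ j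
  ∈-codes₀⁻ {suc n} {j} c∈ with ∈-++⁻ (map (Z ∷_) (codes n j)) c∈
  ... | inj₁ c∈Z with ∈-map⁻ (Z ∷_) c∈Z
  ...   | _ , c′∈ , refl = map₁ (cong suc) (∈-codes⁻ c′∈)
  ∈-codes₀⁻ {suc n} {j} c∈ | inj₂ c∈± =
    extend-elim (codes₀ n) (λ j c → #Z c ≡ 1 × #P c ≡ j) (map₂ (cong suc) ∘ ∈-codes₀⁻) ∈-codes₀⁻ c∈±

  ∈-codes₀⁺ : (c : Vec Sign n) → #Z c ≡ 1 → c ∈ codes₀ n (#P c)
  ∈-codes₀⁺ (Z ∷ c) z≡1 = ∈-++⁺ˡ (∈-map⁺ (Z ∷_) (∈-codes⁺ c (suc-injective z≡1)))
  ∈-codes₀⁺ {suc n} (P ∷ c) z≡1 = ∈-++⁺ʳ (map (Z ∷_) (codes n (suc (#P c)))) (∈-extend-P (codes₀ n) (∈-codes₀⁺ c z≡1))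
  ∈-codes₀⁺ {suc n} (M ∷ c) z≡1 = ∈-++⁺ʳ (map (Z ∷_) (codes n (#P c))) (∈-extend-M (codes₀ n) (∈-codes₀⁺ c z≡1))

  [1+k]*[1+n]C[1+k]≡[1+n]*nCk : ∀ n k → suc k * (suc n C suc k) ≡ suc n * (n C k)
  [1+k]*[1+n]C[1+k]≡[1+n]*nCk zero    zero    = refl
  [1+k]*[1+n]C[1+k]≡[1+n]*nCk zero    (suc k) = *-zeroʳ (suc (suc k))
  [1+k]*[1+n]C[1+k]≡[1+n]*nCk (suc n) zero    =
    trans (+-identityʳ (suc (suc n) C 1)) (trans (nC1≡n (suc (suc n))) (sym (*-identityʳ (suc (suc n)))))
  [1+k]*[1+n]C[1+k]≡[1+n]*nCk (suc n) (suc k) = begin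
    suc (suc k) * (suc (suc n) C suc (suc k))
      ≡⟨ cong (suc (suc k) *_) (sym (nCk+nC[k+1]≡[n+1]C[k+1] (suc n) (suc k))) ⟩
    suc (suc k) * (suc n C suc k + suc n C suc (suc k))
      ≡⟨ *-distribˡ-+ (suc (suc k)) (suc n C suc k) (suc n C suc (suc k)) ⟩
    (suc n C suc k + suc k * (suc n C suc k)) + suc (suc k) * (suc n C suc (suc k))
      ≡⟨ cong₂ (λ a b → (suc n C suc k + a) + b) ([1+k]*[1+n]C[1+k]≡[1+n]*nCk n k) ([1+k]*[1+n]C[1+k]≡[1+n]*nCk n (suc k)) ⟩
    (suc n C suc k + suc n * (n C k)) + suc n * (n C suc k)
      ≡⟨ +-assoc (suc n C suc k) (suc n * (n C k)) (suc n * (n C suc k)) ⟩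
    suc n C suc k + (suc n * (n C k) + suc n * (n C suc k))
      ≡⟨ cong (suc n C suc k +_) (sym (*-distribˡ-+ (suc n) (n C k) (n C suc k))) ⟩
    suc n C suc k + suc n * (n C k + n C suc k)
      ≡⟨ cong (λ a → suc n C suc k + suc n * a) (nCk+nC[k+1]≡[n+1]C[k+1] n k) ⟩
    suc (suc n) * (suc n C suc k) ∎

  bound≡length-codes₀ : ∀ k → let d = suc (k + k) in ⌈ d /2⌉ * (d C ⌈ d /2⌉) ≡ length (codes₀ d k)
  bound≡length-codes₀ k = begin
    ⌈ suc (k + k) /2⌉ * (suc (k + k) C ⌈ suc (k + k) /2⌉) ≡⟨ cong (λ m → m * (suc (k + k) C m)) ⌈1+2k/2⌉≡1+k ⟩
    suc k * (suc (k + k) C suc k)                          ≡⟨ [1+k]*[1+n]C[1+k]≡[1+n]*nCk (k + k) k ⟩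
    suc (k + k) * ((k + k) C k)                            ≡⟨ sym (length-codes₀ (k + k) k) ⟩
    length (codes₀ (suc (k + k)) k)                        ∎
    where
    ⌈1+2k/2⌉≡1+k : ⌈ suc (k + k) /2⌉ ≡ suc k
    ⌈1+2k/2⌉≡1+k = cong suc (sym (n≡⌊n+n/2⌋ k))

  -- Every vector of xs prefixed with P and with M.
  ±∷ : List (Vec Sign n) → List (Vec Sign (suc n))
  ±∷ xs = extend (λ _ → xs) 1

  bound≡length-±∷codes₀ : ∀ k → let d = suc (suc (k + k)) in ⌈ d /2⌉ * (d C ⌈ d /2⌉) ≡ length (±∷ (codes₀ (suc (k + k)) k))
  bound≡length-±∷codes₀ k = begin
    ⌈ suc (suc K) /2⌉ * (suc (suc K) C ⌈ suc (suc K) /2⌉) ≡⟨ cong (λ m → m * (suc (suc K) C m)) ⌈2+2k/2⌉≡1+k ⟩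
    suc k * (suc (suc K) C suc k)                    ≡⟨ [1+k]*[1+n]C[1+k]≡[1+n]*nCk (suc K) k ⟩
    suc (suc K) * (suc K C k)                        ≡⟨ cong₂ _*_ 2+2k≡[1+k]+[1+k] (nCk≡nC[n∸k] (m≤n+m k (suc k))) ⟩
    (suc k + suc k) * (suc K C (suc K ∸ k))          ≡⟨ cong (λ m → (suc k + suc k) * (suc K C m)) (m+n∸n≡m (suc k) k) ⟩
    (suc k + suc k) * (suc K C suc k)                ≡⟨ *-distribʳ-+ (suc K C suc k) (suc k) (suc k) ⟩
    suc k * (suc K C suc k) + suc k * (suc K C suc k) ≡⟨ cong₂ _+_ half half ⟩
    length (codes₀ (suc K) k) + length (codes₀ (suc K) k) ≡⟨ sym (length-extend (λ _ → codes₀ (suc K) k) 0) ⟩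
    length (±∷ (codes₀ (suc K) k))                   ∎
    where
    K = k + k
    ⌈2+2k/2⌉≡1+k : ⌈ suc (suc K) /2⌉ ≡ suc k
    ⌈2+2k/2⌉≡1+k = cong suc (sym (n≡⌈n+n/2⌉ k))
    2+2k≡[1+k]+[1+k] : suc (suc K) ≡ suc k + suc k
    2+2k≡[1+k]+[1+k] = cong suc (sym (+-suc k k))
    half : suc k * (suc K C suc k) ≡ length (codes₀ (suc K) k)
    half = trans ([1+k]*[1+n]C[1+k]≡[1+n]*nCk K k) (sym (length-codes₀ K k))

module CubeSections where
  open import Data.Nat as ℕ using (ℕ; zero; suc)
  open import Data.Nat.Properties using (suc-injective)
  open import Data.Rational using (ℚ; 0ℚ; 1ℚ; ½; _+_; _*_; _-_; -_; _≤_; _<_; _⊓_; positive; nonNegative)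
  open import Data.Rational.Properties
    using (<-cmp; ≤-refl; ≤-reflexive; ≤-trans; <-≤-trans; <-irrefl; ≤-antisym; <⇒≤; ≰⇒>; _≤?_; _<?_;
           +-monoʳ-≤; +-mono-≤; +-mono-<-≤; +-mono-≤-<; neg-antimono-≤; neg-antimono-<; neg-injective;
           p⊓q≤p; p⊓q≤q; ⊓-sel; +-identityˡ; +-identityʳ; *-identityˡ; *-zeroˡ; +-0-group;
           positive⁻¹; nonNegative⁻¹; pos*pos⇒pos; nonNeg*nonNeg⇒nonNeg; module ≤-Reasoning)
  open import Data.Rational.Solver using (module +-*-Solver)
  open +-*-Solver using (solve; _:+_; _:-_; _:*_; :-_; _:=_; con)
  open import Data.Empty using (⊥-elim)
  open import Relation.Binary.Definitions using (tri<; tri≈; tri>)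
  open import Relation.Nullary.Decidable using (toWitness)
  open import Data.Unit using (tt)
  import Data.Fin.Properties as Fin
  open import Algebra.Properties.Group +-0-group using () renaming (∙-cancelˡ to +-cancelˡ; ∙-cancelʳ to +-cancelʳ)
  import Data.Vec.Functional as Vector
  open import Data.Vec using (Vec; []; _∷_; lookup)
  open import Data.List as List using (List; length)
  open import Data.List.Membership.Propositional using (_∈_)
  open import Data.List.Membership.Propositional.Properties using (∈-lookup)
  open import Data.List.Relation.Unary.Any using (index)
  open import Data.List.Relation.Unary.Any.Properties using (lookup-index)
  import Data.List.Relation.Unary.All as All
  open import Data.List.Relation.Unary.Unique.Propositional using (Unique; _∷_)
  open SignVectors

  private variable
    d n : ℕ
    a b c t δ : ℚ

  InInterval Interior ±1 : ℚ → Set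
  InInterval a = - 1ℚ ≤ a × a ≤ 1ℚ
  Interior   a = - 1ℚ < a × a < 1ℚ
  ±1         a = a ≡ 1ℚ ⊎ a ≡ - 1ℚ

  ±1⊎interior : InInterval a → ±1 a ⊎ Interior a
  ±1⊎interior {a} (-1≤a , a≤1) with <-cmp a 1ℚ | <-cmp (- 1ℚ) a
  ... | tri≈ _ a≡1 _  | _               = inj₁ (inj₁ a≡1)
  ... | _             | tri≈ _ -1≡a _   = inj₁ (inj₂ (sym -1≡a))
  ... | tri< a<1 _ _  | tri< -1<a _ _   = inj₂ (-1<a , a<1)
  ... | tri> _ _ 1<a  | _               = ⊥-elim (<-irrefl refl (<-≤-trans 1<a a≤1))
  ... | tri< _ _ _    | tri> _ _ a<-1   = ⊥-elim (<-irrefl refl (<-≤-trans a<-1 -1≤a))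

  ±1⇒InInterval : ±1 a → InInterval a
  ±1⇒InInterval (inj₁ refl) = toWitness {a? = - 1ℚ ≤? 1ℚ} tt , ≤-refl
  ±1⇒InInterval (inj₂ refl) = ≤-refl , toWitness {a? = - 1ℚ ≤? 1ℚ} tt

  neg-interior : Interior a → Interior (- a)
  neg-interior (-1<a , a<1) = neg-antimono-< a<1 , neg-antimono-< -1<a

  *-pos : 0ℚ < a → 0ℚ < b → 0ℚ < a * b
  *-pos {a} {b} 0<a 0<b = positive⁻¹ (a * b) {{pos*pos⇒pos a {{positive 0<a}} b {{positive 0<b}}}}

  *-nonNeg : 0ℚ ≤ a → 0ℚ ≤ b → 0ℚ ≤ a * b
  *-nonNeg {a} {b} 0≤a 0≤b = nonNegative⁻¹ (a * b) {{nonNeg*nonNeg⇒nonNeg a {{nonNegative 0≤a}} b {{nonNegative 0≤b}}}}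

  1-t-pos : t < 1ℚ → 0ℚ < 1ℚ - t
  1-t-pos {t} t<1 = subst (_< 1ℚ - t) (solve 1 (λ t → t :+ (:- t) := con 0ℚ) refl t) (+-mono-<-≤ t<1 (≤-refl { - t}))

  ⊓-pos : 0ℚ < a → 0ℚ < b → 0ℚ < a ⊓ b
  ⊓-pos {a} {b} 0<a 0<b with ⊓-sel a b
  ... | inj₁ a⊓b≡a = subst (0ℚ <_) (sym a⊓b≡a) 0<a
  ... | inj₂ a⊓b≡b = subst (0ℚ <_) (sym a⊓b≡b) 0<b

  slack : ℚ → ℚ
  slack a = (1ℚ - a) ⊓ (1ℚ + a)

  slack-pos : Interior a → 0ℚ < slack a
  slack-pos {a} (-1<a , a<1) =
    ⊓-pos (1-t-pos a<1) (subst (0ℚ <_) (solve 1 (λ a → con 1ℚ :- (:- a) := con 1ℚ :+ a) refl a) (1-t-pos (neg-antimono-< -1<a)))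

  Shiftable : ℚ → ℚ → Set
  Shiftable a δ = InInterval (a + δ) × InInterval (a - δ)

  shiftable-0 : InInterval a → Shiftable a 0ℚ
  shiftable-0 {a} a∈ = subst InInterval (sym (+-identityʳ a)) a∈ , subst InInterval (sym (+-identityʳ a)) a∈

  shiftable-neg : Shiftable a δ → Shiftable a (- δ)
  shiftable-neg {a} {δ} (a+δ∈ , a-δ∈) = a-δ∈ , subst InInterval (solve 2 (λ a δ → a :+ δ := a :- (:- δ)) refl a δ) a+δ∈

  shiftable-slack : 0ℚ ≤ δ → δ ≤ slack a → Shiftable a δ
  shiftable-slack {δ} {a} 0≤δ δ≤slack = (≤-trans lower middle , upper) , (lower , ≤-trans middle upper)
    where
    open ≤-Reasoning
    middle : a - δ ≤ a + δ
    middle = +-monoʳ-≤ a (≤-trans (neg-antimono-≤ 0≤δ) 0≤δ)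
    upper : a + δ ≤ 1ℚ
    upper = begin
      a + δ         ≤⟨ +-monoʳ-≤ a (≤-trans δ≤slack (p⊓q≤p (1ℚ - a) (1ℚ + a))) ⟩
      a + (1ℚ - a)  ≡⟨ solve 1 (λ a → a :+ (con 1ℚ :- a) := con 1ℚ) refl a ⟩
      1ℚ            ∎
    lower : - 1ℚ ≤ a - δ
    lower = begin
      - 1ℚ           ≡⟨ solve 1 (λ a → con (- 1ℚ) := a :- (con 1ℚ :+ a)) refl a ⟩
      a - (1ℚ + a)   ≤⟨ +-monoʳ-≤ a (neg-antimono-≤ (≤-trans δ≤slack (p⊓q≤q (1ℚ - a) (1ℚ + a)))) ⟩
      a - δ          ∎

  convex-zero : 0ℚ < t → t < 1ℚ → 0ℚ ≤ a → 0ℚ ≤ b → t * a + (1ℚ - t) * b ≡ 0ℚ → a ≡ 0ℚ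
  convex-zero {t} {a} {b} 0<t t<1 0≤a 0≤b sum≡0 with a ≤? 0ℚ
  ... | yes a≤0 = ≤-antisym a≤0 0≤a
  ... | no  a≰0 = ⊥-elim (<-irrefl (sym sum≡0) (+-mono-<-≤ (*-pos 0<t (≰⇒> a≰0)) (*-nonNeg (<⇒≤ (1-t-pos t<1)) 0≤b)))

  convex-top : 0ℚ < t → t < 1ℚ → a ≤ 1ℚ → b ≤ 1ℚ → 1ℚ ≡ t * a + (1ℚ - t) * b → a ≡ b
  convex-top {t} {a} {b} 0<t t<1 a≤1 b≤1 1≡ta+sb =
    trans (1-x≡0⇒x≡1 a (convex-zero 0<t t<1 (0≤1-x a≤1) (0≤1-x b≤1) gap≡0))
          (sym (1-x≡0⇒x≡1 b (convex-zero (1-t-pos t<1) 1-t<1 (0≤1-x b≤1) (0≤1-x a≤1) gap≡0′)))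
    where
    0≤1-x : ∀ {x} → x ≤ 1ℚ → 0ℚ ≤ 1ℚ - x
    0≤1-x {x} x≤1 = subst (_≤ 1ℚ - x) (solve 1 (λ x → x :+ (:- x) := con 0ℚ) refl x) (+-mono-≤ x≤1 (≤-refl { - x}))
    1-x≡0⇒x≡1 : ∀ x → 1ℚ - x ≡ 0ℚ → x ≡ 1ℚ
    1-x≡0⇒x≡1 x eq = trans (solve 1 (λ x → x := con 1ℚ :- (con 1ℚ :- x)) refl x) (cong (λ y → 1ℚ - y) eq)
    1-t<1 : 1ℚ - t < 1ℚ
    1-t<1 = subst₂ _<_ (solve 1 (λ t → con 1ℚ :- t :+ con 0ℚ := con 1ℚ :- t) refl t) (solve 1 (λ t → con 1ℚ :- t :+ t := con 1ℚ) refl t)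
              (+-mono-≤-< (≤-refl {1ℚ - t}) 0<t)
    gap≡0 : t * (1ℚ - a) + (1ℚ - t) * (1ℚ - b) ≡ 0ℚ
    gap≡0 = trans (solve 3 (λ t a b → t :* (con 1ℚ :- a) :+ (con 1ℚ :- t) :* (con 1ℚ :- b) := con 1ℚ :- (t :* a :+ (con 1ℚ :- t) :* b)) refl t a b)
                  (cong (λ y → 1ℚ - y) (sym 1≡ta+sb))
    gap≡0′ : (1ℚ - t) * (1ℚ - b) + (1ℚ - (1ℚ - t)) * (1ℚ - a) ≡ 0ℚ
    gap≡0′ = trans (solve 3 (λ t a b → (con 1ℚ :- t) :* (con 1ℚ :- b) :+ (con 1ℚ :- (con 1ℚ :- t)) :* (con 1ℚ :- a) := t :* (con 1ℚ :- a) :+ (con 1ℚ :- t) :* (con 1ℚ :- b)) refl t a b) gap≡0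

  ±1-extreme : ±1 a → InInterval b → InInterval c → 0ℚ < t → t < 1ℚ → a ≡ t * b + (1ℚ - t) * c → b ≡ c
  ±1-extreme (inj₁ refl) (_ , b≤1) (_ , c≤1) 0<t t<1 eq = convex-top 0<t t<1 b≤1 c≤1 eq
  ±1-extreme {b = b} {c} {t} (inj₂ refl) (-1≤b , _) (-1≤c , _) 0<t t<1 eq =
    neg-injective (convex-top 0<t t<1 (neg-antimono-≤ -1≤b) (neg-antimono-≤ -1≤c)
      (trans (cong -_ eq) (solve 3 (λ t b c → :- (t :* b :+ (con 1ℚ :- t) :* c) := t :* (:- b) :+ (con 1ℚ :- t) :* (:- c)) refl t b c)))

  dot-cong : ∀ (u : Point d) {x y} → x ≐ y → dot u x ≡ dot u y
  dot-cong {zero}  u x≐y = refl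
  dot-cong {suc d} u x≐y = cong₂ _+_ (cong (u zero *_) (x≐y zero)) (dot-cong (tail u) (x≐y ∘ suc))

  dot-+ : ∀ (u x y : Point d) → dot u (λ i → x i + y i) ≡ dot u x + dot u y
  dot-+ {zero}  u x y = refl
  dot-+ {suc d} u x y = trans (cong (u zero * (x zero + y zero) +_) (dot-+ (tail u) (tail x) (tail y)))
    (solve 5 (λ a b c p q → a :* (b :+ c) :+ (p :+ q) := (a :* b :+ p) :+ (a :* c :+ q)) refl
       (u zero) (x zero) (y zero) (dot (tail u) (tail x)) (dot (tail u) (tail y)))

  dot-− : ∀ (u x y : Point d) → dot u (λ i → x i - y i) ≡ dot u x - dot u y
  dot-− {zero}  u x y = refl
  dot-− {suc d} u x y = trans (cong (u zero * (x zero - y zero) +_) (dot-− (tail u) (tail x) (tail y)))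
    (solve 5 (λ a b c p q → a :* (b :- c) :+ (p :- q) := (a :* b :+ p) :- (a :* c :+ q)) refl
       (u zero) (x zero) (y zero) (dot (tail u) (tail x)) (dot (tail u) (tail y)))

  dot-0 : ∀ (u : Point d) → dot u (λ _ → 0ℚ) ≡ 0ℚ
  dot-0 {zero}  u = refl
  dot-0 {suc d} u = trans (cong (u zero * 0ℚ +_) (dot-0 (tail u))) (solve 1 (λ a → a :* con 0ℚ :+ con 0ℚ := con 0ℚ) refl (u zero))

  single : Fin d → ℚ → Point d
  single zero    a zero    = a
  single zero    a (suc l) = 0ℚ
  single (suc i) a zero    = 0ℚ
  single (suc i) a (suc l) = single i a l

  single-≡ : ∀ (i : Fin d) a → single i a i ≡ a
  single-≡ zero    a = refl
  single-≡ (suc i) a = single-≡ i a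

  single-≢ : ∀ {i l : Fin d} a → i ≢ l → single i a l ≡ 0ℚ
  single-≢ {i = zero}  {zero}  a i≢l = ⊥-elim (i≢l refl)
  single-≢ {i = zero}  {suc l} a i≢l = refl
  single-≢ {i = suc i} {zero}  a i≢l = refl
  single-≢ {i = suc i} {suc l} a i≢l = single-≢ a (i≢l ∘ cong suc)

  single-0 : ∀ (i l : Fin d) → single i 0ℚ l ≡ 0ℚ
  single-0 zero    zero    = refl
  single-0 zero    (suc l) = refl
  single-0 (suc i) zero    = refl
  single-0 (suc i) (suc l) = single-0 i l

  dot-single : ∀ (u : Point d) i a → dot u (single i a) ≡ u i * a
  dot-single {suc d} u zero a = trans (cong (u zero * a +_) (dot-0 (tail u))) (+-identityʳ (u zero * a))
  dot-single {suc d} u (suc i) a = trans (cong (u zero * 0ℚ +_) (dot-single (tail u) i a))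
    (solve 2 (λ a b → a :* con 0ℚ :+ b := b) refl (u zero) (u (suc i) * a))

  vertex⇒shift≡0 : ∀ {u x w : Point d} → IsVertex (Section u) x → dot u w ≡ 0ℚ →
                 (∀ l → Shiftable (x l) (w l)) → ∀ i → w i ≡ 0ℚ
  vertex⇒shift≡0 {u = u} {x} {w} ((_ , ux≡0) , extreme) uw≡0 shiftable i =
    trans (solve 2 (λ a b → b := con ½ :* ((a :+ b) :- (a :- b))) refl (x i) (w i))
      (trans (cong (λ y → ½ * (y - (x i - w i))) (x+w≐x-w i)) (solve 2 (λ a b → con ½ :* ((a :- b) :- (a :- b)) := con 0ℚ) refl (x i) (w i)))
    where
    x+w∈ : Section u (λ l → x l + w l)
    x+w∈ = proj₁ ∘ shiftable , trans (dot-+ u x w) (cong₂ _+_ ux≡0 uw≡0)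
    x-w∈ : Section u (λ l → x l - w l)
    x-w∈ = proj₂ ∘ shiftable , trans (dot-− u x w) (cong₂ _-_ ux≡0 uw≡0)
    x+w≐x-w : (λ l → x l + w l) ≐ (λ l → x l - w l)
    x+w≐x-w = extreme _ _ ½ x+w∈ x-w∈ (toWitness {a? = 0ℚ <? ½} tt) (toWitness {a? = ½ <? 1ℚ} tt)
      (λ l → solve 2 (λ a b → a := con ½ :* (a :+ b) :+ (con 1ℚ :- con ½) :* (a :- b)) refl (x l) (w l))

  two-interior⇒¬vertex : ∀ {u x : Point d} {i j} → u i ≡ u j → i ≢ j → Interior (x i) → Interior (x j) →
                         ¬ IsVertex (Section u) x
  two-interior⇒¬vertex {d} {u} {x} {i} {j} uᵢ≡uⱼ i≢j xᵢ° xⱼ° vertex@((cube , _) , _) =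
    <-irrefl (trans (sym (vertex⇒shift≡0 vertex uw≡0 shiftable i)) wᵢ≡ε) 0<ε
    where
    ε : ℚ
    ε = slack (x i) ⊓ slack (x j)
    0<ε : 0ℚ < ε
    0<ε = ⊓-pos (slack-pos xᵢ°) (slack-pos xⱼ°)
    w : Point d
    w l = single i ε l - single j ε l
    uw≡0 : dot u w ≡ 0ℚ
    uw≡0 = begin
      dot u w                                  ≡⟨ dot-− u (single i ε) (single j ε) ⟩
      dot u (single i ε) - dot u (single j ε)  ≡⟨ cong₂ _-_ (dot-single u i ε) (dot-single u j ε) ⟩
      u i * ε - u j * ε                        ≡⟨ cong (λ v → v * ε - u j * ε) uᵢ≡uⱼ ⟩
      u j * ε - u j * ε                        ≡⟨ solve 2 (λ v ε → v :* ε :- v :* ε := con 0ℚ) refl (u j) ε ⟩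
      0ℚ                                       ∎
      where open ≡-Reasoning
    wᵢ≡ε : w i ≡ ε
    wᵢ≡ε = trans (cong₂ _-_ (single-≡ i ε) (single-≢ ε (i≢j ∘ sym))) (solve 1 (λ ε → ε :- con 0ℚ := ε) refl ε)
    shiftable : ∀ l → Shiftable (x l) (w l)
    shiftable l with i Fin.≟ l | j Fin.≟ l
    ... | yes refl | _ = subst (Shiftable (x i)) (sym wᵢ≡ε) (shiftable-slack {a = x l} (<⇒≤ 0<ε) (p⊓q≤p (slack (x l)) (slack (x j))))
    ... | no i≢j′ | yes refl = subst (Shiftable (x j)) (sym wⱼ≡-ε) (shiftable-neg {a = x l} (shiftable-slack {a = x l} (<⇒≤ 0<ε) (p⊓q≤q (slack (x i)) (slack (x l)))))
      where
      wⱼ≡-ε : w j ≡ - ε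
      wⱼ≡-ε = trans (cong₂ _-_ (single-≢ ε i≢j′) (single-≡ j ε)) (+-identityˡ (- ε))
    ... | no i≢l | no j≢l = subst (Shiftable (x l)) (sym wₗ≡0) (shiftable-0 (cube l))
      where
      wₗ≡0 : w l ≡ 0ℚ
      wₗ≡0 = cong₂ _-_ (single-≢ ε i≢l) (single-≢ ε j≢l)

  zero-weight-interior⇒¬vertex : ∀ {u x : Point d} {i} → u i ≡ 0ℚ → Interior (x i) → ¬ IsVertex (Section u) x
  zero-weight-interior⇒¬vertex {u = u} {x} {i} uᵢ≡0 xᵢ° vertex@((cube , _) , _) =
    <-irrefl (trans (sym (vertex⇒shift≡0 vertex uw≡0 shiftable i)) (single-≡ i ε)) (slack-pos xᵢ°)
    where
    ε : ℚ
    ε = slack (x i)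
    uw≡0 : dot u (single i ε) ≡ 0ℚ
    uw≡0 = trans (dot-single u i ε) (trans (cong (_* ε) uᵢ≡0) (*-zeroˡ ε))
    shiftable : ∀ l → Shiftable (x l) (single i ε l)
    shiftable l with i Fin.≟ l
    ... | yes refl = subst (Shiftable (x i)) (sym (single-≡ i ε)) (shiftable-slack {a = x l} (<⇒≤ (slack-pos xᵢ°)) (≤-refl {ε}))
    ... | no i≢l = subst (Shiftable (x l)) (sym (single-≢ ε i≢l)) (shiftable-0 (cube l))

  module _ {u : Point (suc d)} (u₀≡0 : u zero ≡ 0ℚ) where

    dot-tail : ∀ x → dot u x ≡ dot (tail u) (tail x)
    dot-tail x = trans (cong (λ v → v * x zero + dot (tail u) (tail x)) u₀≡0)
                       (solve 2 (λ a b → con 0ℚ :* a :+ b := b) refl (x zero) (dot (tail u) (tail x)))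

    section-tail : ∀ {x} → Section u x → Section (tail u) (tail x)
    section-tail {x} (cube , ux≡0) = cube ∘ suc , trans (sym (dot-tail x)) ux≡0

    vertex-tail⁺ : ∀ {x} → ±1 (x zero) → IsVertex (Section (tail u)) (tail x) → IsVertex (Section u) x
    vertex-tail⁺ {x} ±1x₀ ((cube , ux≡0) , extreme) = (cube′ , trans (dot-tail x) ux≡0) , extreme′
      where
      cube′ : InCube x
      cube′ zero    = ±1⇒InInterval ±1x₀
      cube′ (suc i) = cube i
      extreme′ : ∀ y z t → Section u y → Section u z → 0ℚ < t → t < 1ℚ →
                 x ≐ (λ i → t * y i + (1ℚ - t) * z i) → y ≐ z
      extreme′ y z t y∈ z∈ 0<t t<1 x≐ zero    = ±1-extreme ±1x₀ (proj₁ y∈ zero) (proj₁ z∈ zero) 0<t t<1 (x≐ zero)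
      extreme′ y z t y∈ z∈ 0<t t<1 x≐ (suc i) = extreme (tail y) (tail z) t (section-tail y∈) (section-tail z∈) 0<t t<1 (x≐ ∘ suc) i

    vertex-tail⁻ : ∀ {x} → IsVertex (Section u) x → ±1 (x zero) × IsVertex (Section (tail u)) (tail x)
    vertex-tail⁻ {x} vertex@(x∈@(cube , _) , extreme) = ±1x₀ , section-tail x∈ , extreme′
      where
      ±1x₀ : ±1 (x zero)
      ±1x₀ with ±1⊎interior (cube zero)
      ... | inj₁ ±1x₀ = ±1x₀
      ... | inj₂ x₀° = ⊥-elim (zero-weight-interior⇒¬vertex {u = u} u₀≡0 x₀° vertex)
      x₀∷_ : Point d → Point (suc d)
      x₀∷ y = x zero Vector.∷ y
      x₀∷-section : ∀ {y} → Section (tail u) y → Section u (x₀∷ y)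
      x₀∷-section {y} (cube′ , uy≡0) = (λ { zero → cube zero ; (suc i) → cube′ i }) , trans (dot-tail (x₀∷ y)) uy≡0
      extreme′ : ∀ y z t → Section (tail u) y → Section (tail u) z → 0ℚ < t → t < 1ℚ →
                 tail x ≐ (λ i → t * y i + (1ℚ - t) * z i) → y ≐ z
      extreme′ y z t y∈ z∈ 0<t t<1 x≐ =
        extreme (x₀∷ y) (x₀∷ z) t (x₀∷-section y∈) (x₀∷-section z∈) 0<t t<1
          (λ { zero → solve 2 (λ a t → a := t :* a :+ (con 1ℚ :- t) :* a) refl (x zero) t ; (suc i) → x≐ i })
        ∘ suc

  lookup-injective : ∀ {X : Set} {xs : List X} → Unique xs → ∀ i j → List.lookup xs i ≡ List.lookup xs j → i ≡ j
  lookup-injective (_  ∷ _) zero    zero    _  = refl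
  lookup-injective (x∉ ∷ _) zero    (suc j) eq = ⊥-elim (All.lookup x∉ (∈-lookup j) eq)
  lookup-injective (x∉ ∷ _) (suc i) zero    eq = ⊥-elim (All.lookup x∉ (∈-lookup i) (sym eq))
  lookup-injective (_  ∷ u) (suc i) (suc j) eq = cong suc (lookup-injective u i j eq)

  enumerate : ∀ {X : Set} (S : Point d → Set) (f : X → Point d) → (∀ a b → f a ≐ f b → a ≡ b) →
              ∀ {xs} → Unique xs → (∀ {a} → a ∈ xs → IsVertex S (f a)) →
              (∀ x → IsVertex S x → Σ X λ a → a ∈ xs × x ≐ f a) → HasExactlyVertices S (length xs)
  enumerate S f f-injective {xs} unique sound complete =
    f ∘ List.lookup xs , sound ∘ ∈-lookup , (λ i j fᵢ≐fⱼ → lookup-injective unique i j (f-injective _ _ fᵢ≐fⱼ)) , index-of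
    where
    index-of : ∀ x → IsVertex S x → Σ (Fin (length xs)) λ i → x ≐ f (List.lookup xs i)
    index-of x vertex with complete x vertex
    ... | a , a∈ , x≐ = index a∈ , λ l → trans (x≐ l) (cong (λ b → f b l) (lookup-index a∈))

  value : Sign → ℚ
  value P = 1ℚ
  value M = - 1ℚ
  value Z = 0ℚ

  decode : Vec Sign n → Point n
  decode c l = value (lookup c l)

  value-injective : ∀ {s s′} → value s ≡ value s′ → s ≡ s′
  value-injective {P} {P} _ = refl
  value-injective {M} {M} _ = refl
  value-injective {Z} {Z} _ = refl
  value-injective {P} {M} ()
  value-injective {P} {Z} ()
  value-injective {M} {P} ()
  value-injective {M} {Z} ()
  value-injective {Z} {P} ()
  value-injective {Z} {M} ()

  decode-injective : (c c′ : Vec Sign n) → decode c ≐ decode c′ → c ≡ c′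
  decode-injective []      []        _  = refl
  decode-injective (s ∷ c) (s′ ∷ c′) c≐ = cong₂ _∷_ (value-injective (c≐ zero)) (decode-injective c c′ (c≐ ∘ suc))

  value-InInterval : ∀ s → InInterval (value s)
  value-InInterval P = ±1⇒InInterval (inj₁ refl)
  value-InInterval M = ±1⇒InInterval (inj₂ refl)
  value-InInterval Z = toWitness {a? = - 1ℚ ≤? 0ℚ} tt , toWitness {a? = 0ℚ ≤? 1ℚ} tt

  value-±1 : ∀ s → s ≢ Z → ±1 (value s)
  value-±1 P _   = inj₁ refl
  value-±1 M _   = inj₂ refl
  value-±1 Z s≢Z = ⊥-elim (s≢Z refl)

  fromℕ : ℕ → ℚ
  fromℕ zero    = 0ℚ
  fromℕ (suc m) = 1ℚ + fromℕ m

  1≤fromℕ[1+m] : ∀ m → 1ℚ ≤ fromℕ (suc m)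
  1≤fromℕ[1+m] zero    = ≤-reflexive (sym (+-identityʳ 1ℚ))
  1≤fromℕ[1+m] (suc m) = ≤-trans (1≤fromℕ[1+m] m)
    (subst (_≤ 1ℚ + fromℕ (suc m)) (+-identityˡ (fromℕ (suc m)))
      (+-mono-≤ (toWitness {a? = 0ℚ ≤? 1ℚ} tt) (≤-refl {fromℕ (suc m)})))

  fromℕ-diff-interior⇒≡ : ∀ p m → Interior (fromℕ p - fromℕ m) → p ≡ m
  fromℕ-diff-interior⇒≡ zero    zero    _          = refl
  fromℕ-diff-interior⇒≡ zero    (suc m) (-1< , _)  = ⊥-elim (<-irrefl refl (<-≤-trans -1< (begin
    0ℚ - fromℕ (suc m)  ≡⟨ +-identityˡ (- fromℕ (suc m)) ⟩
    - fromℕ (suc m)     ≤⟨ neg-antimono-≤ (1≤fromℕ[1+m] m) ⟩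
    - 1ℚ                ∎)))
    where open ≤-Reasoning
  fromℕ-diff-interior⇒≡ (suc p) zero    (_ , <1)   = ⊥-elim (<-irrefl refl (<-≤-trans <1 (begin
    1ℚ                  ≤⟨ 1≤fromℕ[1+m] p ⟩
    fromℕ (suc p)       ≡⟨ sym (+-identityʳ (fromℕ (suc p))) ⟩
    fromℕ (suc p) - 0ℚ  ∎)))
    where open ≤-Reasoning
  fromℕ-diff-interior⇒≡ (suc p) (suc m) interior = cong suc (fromℕ-diff-interior⇒≡ p m
    (subst Interior (solve 2 (λ a b → (con 1ℚ :+ a) :- (con 1ℚ :+ b) := a :- b) refl (fromℕ p) (fromℕ m)) interior))

  ones : Point n
  ones _ = 1ℚ

  dot-ones-decode : (c : Vec Sign n) → dot ones (decode c) ≡ fromℕ (#P c) - fromℕ (#M c)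
  dot-ones-decode []      = refl
  dot-ones-decode (P ∷ c) = trans (cong (1ℚ * 1ℚ +_) (dot-ones-decode c))
    (solve 2 (λ p m → con 1ℚ :* con 1ℚ :+ (p :- m) := (con 1ℚ :+ p) :- m) refl (fromℕ (#P c)) (fromℕ (#M c)))
  dot-ones-decode (M ∷ c) = trans (cong (1ℚ * - 1ℚ +_) (dot-ones-decode c))
    (solve 2 (λ p m → con 1ℚ :* con (- 1ℚ) :+ (p :- m) := p :- (con 1ℚ :+ m)) refl (fromℕ (#P c)) (fromℕ (#M c)))
  dot-ones-decode (Z ∷ c) = trans (cong (1ℚ * 0ℚ +_) (dot-ones-decode c))
    (solve 2 (λ p m → con 1ℚ :* con 0ℚ :+ (p :- m) := p :- m) refl (fromℕ (#P c)) (fromℕ (#M c)))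

  interior-dot⇒balanced : (c : Vec Sign n) → Interior (dot ones (decode c)) → #P c ≡ #M c
  interior-dot⇒balanced c = fromℕ-diff-interior⇒≡ (#P c) (#M c) ∘ subst Interior (dot-ones-decode c)

  balanced⇒dot≡0 : (c : Vec Sign n) → #P c ≡ #M c → dot ones (decode c) ≡ 0ℚ
  balanced⇒dot≡0 c p≡m = trans (dot-ones-decode c)
    (trans (cong (λ m → fromℕ (#P c) - fromℕ m) (sym p≡m)) (solve 1 (λ p → p :- p := con 0ℚ) refl (fromℕ (#P c))))

  ≐-head-tail : ∀ {y z : Point (suc n)} → y zero ≡ z zero → tail y ≐ tail z → y ≐ z
  ≐-head-tail y₀≡z₀ tail≐ zero    = y₀≡z₀
  ≐-head-tail y₀≡z₀ tail≐ (suc l) = tail≐ l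

  SignsAgree : Vec Sign n → Point n → Point n → Set
  SignsAgree c y z = ∀ l → lookup c l ≢ Z → y l ≡ z l

  tail-sum : ∀ {y z : Point (suc n)} → y zero ≡ z zero → dot ones y ≡ dot ones z → dot ones (tail y) ≡ dot ones (tail z)
  tail-sum {y = y} {z} y₀≡z₀ sum≡ = +-cancelˡ (1ℚ * y zero) (dot ones (tail y)) (dot ones (tail z))
    (trans sum≡ (cong (λ a → 1ℚ * a + dot ones (tail z)) (sym y₀≡z₀)))

  signsAgree⇒≐ : ∀ (c : Vec Sign n) {y z} → #Z c ≡ 0 → SignsAgree c y z → y ≐ z
  signsAgree⇒≐ (P ∷ c) z≡0 agree zero    = agree zero (λ ())
  signsAgree⇒≐ (P ∷ c) z≡0 agree (suc l) = signsAgree⇒≐ c z≡0 (agree ∘ suc) l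
  signsAgree⇒≐ (M ∷ c) z≡0 agree zero    = agree zero (λ ())
  signsAgree⇒≐ (M ∷ c) z≡0 agree (suc l) = signsAgree⇒≐ c z≡0 (agree ∘ suc) l

  signsAgree-sum⇒≐ : ∀ (c : Vec Sign n) {y z} → #Z c ≡ 1 → SignsAgree c y z → dot ones y ≡ dot ones z → y ≐ z
  signsAgree-sum⇒≐ (Z ∷ c) {y} {z} z≡1 agree sum≡ = ≐-head-tail y₀≡z₀ tail≐
    where
    tail≐ : tail y ≐ tail z
    tail≐ = signsAgree⇒≐ c (suc-injective z≡1) (agree ∘ suc)
    y₀≡z₀ : y zero ≡ z zero
    y₀≡z₀ = begin
      y zero      ≡⟨ sym (*-identityˡ (y zero)) ⟩
      1ℚ * y zero ≡⟨ +-cancelʳ (dot ones (tail y)) (1ℚ * y zero) (1ℚ * z zero)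
                       (trans sum≡ (cong (1ℚ * z zero +_) (sym (dot-cong ones tail≐)))) ⟩
      1ℚ * z zero ≡⟨ *-identityˡ (z zero) ⟩
      z zero      ∎
      where open ≡-Reasoning
  signsAgree-sum⇒≐ (P ∷ c) {y} {z} z≡1 agree sum≡ =
    ≐-head-tail (agree zero (λ ())) (signsAgree-sum⇒≐ c z≡1 (agree ∘ suc) (tail-sum {y = y} {z} (agree zero (λ ())) sum≡))
  signsAgree-sum⇒≐ (M ∷ c) {y} {z} z≡1 agree sum≡ =
    ≐-head-tail (agree zero (λ ())) (signsAgree-sum⇒≐ c z≡1 (agree ∘ suc) (tail-sum {y = y} {z} (agree zero (λ ())) sum≡))

  balanced⇒vertex : (c : Vec Sign n) → #Z c ≡ 1 → #P c ≡ #M c → IsVertex (Section ones) (decode c)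
  balanced⇒vertex c z≡1 p≡m = (value-InInterval ∘ lookup c , balanced⇒dot≡0 c p≡m) , extreme
    where
    extreme : ∀ y z t → Section ones y → Section ones z → 0ℚ < t → t < 1ℚ →
              decode c ≐ (λ i → t * y i + (1ℚ - t) * z i) → y ≐ z
    extreme y z t (y∈ , y-sum) (z∈ , z-sum) 0<t t<1 c≐ = signsAgree-sum⇒≐ c z≡1
      (λ l cₗ≢Z → ±1-extreme (value-±1 (lookup c l) cₗ≢Z) (y∈ l) (z∈ l) 0<t t<1 (c≐ l)) (trans y-sum (sym z-sum))

  data Shape {n} (x : Point n) : Set where
    corner : (c : Vec Sign n) → #Z c ≡ 0 → x ≐ decode c → Shape x
    edge   : (c : Vec Sign n) (i : Fin n) → #Z c ≡ 1 → Interior (x i) →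
             x ≐ (λ l → decode c l + single i (x i) l) → Shape x
    face   : (i j : Fin n) → i ≢ j → Interior (x i) → Interior (x j) → Shape x

  ±1∷-shape : ∀ {x : Point (suc n)} → ±1 (x zero) → Shape (tail x) → Shape x
  ±1∷-shape (inj₁ x₀≡1)  (corner c z≡0 x≐) = corner (P ∷ c) z≡0 (≐-head-tail x₀≡1 x≐)
  ±1∷-shape (inj₂ x₀≡-1) (corner c z≡0 x≐) = corner (M ∷ c) z≡0 (≐-head-tail x₀≡-1 x≐)
  ±1∷-shape (inj₁ x₀≡1)  (edge c i z≡1 xᵢ° x≐) = edge (P ∷ c) (suc i) z≡1 xᵢ° (≐-head-tail (trans x₀≡1 (sym (+-identityʳ 1ℚ))) x≐)
  ±1∷-shape (inj₂ x₀≡-1) (edge c i z≡1 xᵢ° x≐) = edge (M ∷ c) (suc i) z≡1 xᵢ° (≐-head-tail (trans x₀≡-1 (sym (+-identityʳ (- 1ℚ)))) x≐)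
  ±1∷-shape _ (face i j i≢j xᵢ° xⱼ°) = face (suc i) (suc j) (i≢j ∘ Fin.suc-injective) xᵢ° xⱼ°

  interior∷-shape : ∀ {x : Point (suc n)} → Interior (x zero) → Shape (tail x) → Shape x
  interior∷-shape {x = x} x₀° (corner c z≡0 x≐) =
    edge (Z ∷ c) zero (cong suc z≡0) x₀° (≐-head-tail (sym (+-identityˡ (x zero))) (λ l → trans (x≐ l) (sym (+-identityʳ _))))
  interior∷-shape x₀° (edge c i _ xᵢ° _) = face zero (suc i) (λ ()) x₀° xᵢ°
  interior∷-shape x₀° (face i _ _ xᵢ° _) = face zero (suc i) (λ ()) x₀° xᵢ°

  shape : ∀ (x : Point n) → InCube x → Shape x
  shape {zero}  x _    = corner [] refl (λ ())
  shape {suc n} x cube with ±1⊎interior (cube zero)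
  ... | inj₁ ±1x₀ = ±1∷-shape ±1x₀ (shape (tail x) (cube ∘ suc))
  ... | inj₂ x₀°  = interior∷-shape x₀° (shape (tail x) (cube ∘ suc))

  cubeVertex⇒corner : ∀ (v : Point n) → CubeVertex v → Σ (Vec Sign n) λ c → #Z c ≡ 0 × v ≐ decode c
  cubeVertex⇒corner {zero}  v _  = [] , refl , λ ()
  cubeVertex⇒corner {suc n} v cv with cubeVertex⇒corner (tail v) (cv ∘ suc) | cv zero
  ... | c , z≡0 , v≐ | inj₁ v₀≡1  = P ∷ c , z≡0 , ≐-head-tail v₀≡1 v≐
  ... | c , z≡0 , v≐ | inj₂ v₀≡-1 = M ∷ c , z≡0 , ≐-head-tail v₀≡-1 v≐

  odd-corner∉ones⊥ : ∀ k (c : Vec Sign (suc (k ℕ.+ k))) → #Z c ≡ 0 → dot ones (decode c) ≢ 0ℚ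
  odd-corner∉ones⊥ k c z≡0 sum≡0 =
    #Z≡0⇒unbalanced {k = k} c z≡0 (interior-dot⇒balanced c (subst Interior (sym sum≡0) (toWitness {a? = - 1ℚ <? 0ℚ} tt , toWitness {a? = 0ℚ <? 1ℚ} tt)))

  cubeVertex∉ones⊥ : ∀ k (v : Point (suc (k ℕ.+ k))) → CubeVertex v → dot ones v ≢ 0ℚ
  cubeVertex∉ones⊥ k v cv with cubeVertex⇒corner v cv
  ... | c , z≡0 , v≐ = odd-corner∉ones⊥ k c z≡0 ∘ trans (sym (dot-cong ones v≐))

  ∈codes₀⇒vertex : ∀ k {c} → c ∈ codes₀ (suc (k ℕ.+ k)) k → IsVertex (Section ones) (decode c)
  ∈codes₀⇒vertex k {c} c∈ with ∈-codes₀⁻ c∈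
  ... | z≡1 , p≡k = balanced⇒vertex c z≡1 (trans p≡k (sym (#P≡k⇒#M≡k {k = k} c z≡1 p≡k)))

  edge∈ones⊥⇒balanced : ∀ (c : Vec Sign n) {x : Point n} i → Interior (x i) →
                        x ≐ (λ l → decode c l + single i (x i) l) → dot ones x ≡ 0ℚ → #P c ≡ #M c × x ≐ decode c
  edge∈ones⊥⇒balanced c {x} i xᵢ° x≐ sum≡0 = balanced , x≐c
    where
    open ≡-Reasoning
    D : ℚ
    D = dot ones (decode c)
    D+xᵢ≡0 : D + x i ≡ 0ℚ
    D+xᵢ≡0 = begin
      D + x i                                          ≡⟨ cong (D +_) (sym (trans (dot-single ones i (x i)) (*-identityˡ (x i)))) ⟩
      D + dot ones (single i (x i))                    ≡⟨ sym (dot-+ ones (decode c) (single i (x i))) ⟩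
      dot ones (λ l → decode c l + single i (x i) l)   ≡⟨ sym (dot-cong ones x≐) ⟩
      dot ones x                                       ≡⟨ sum≡0 ⟩
      0ℚ                                               ∎
    D≡-xᵢ : D ≡ - x i
    D≡-xᵢ = trans (solve 2 (λ D a → D := (D :+ a) :- a) refl D (x i)) (trans (cong (_- x i) D+xᵢ≡0) (+-identityˡ (- x i)))
    balanced : #P c ≡ #M c
    balanced = interior-dot⇒balanced c (subst Interior (sym D≡-xᵢ) (neg-interior xᵢ°))
    xᵢ≡0 : x i ≡ 0ℚ
    xᵢ≡0 = begin
      x i            ≡⟨ solve 2 (λ D a → a := (D :+ a) :- D) refl D (x i) ⟩
      (D + x i) - D  ≡⟨ cong₂ _-_ D+xᵢ≡0 (balanced⇒dot≡0 c balanced) ⟩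
      0ℚ - 0ℚ        ≡⟨⟩
      0ℚ             ∎
    x≐c : x ≐ decode c
    x≐c l = begin
      x l                                ≡⟨ x≐ l ⟩
      decode c l + single i (x i) l      ≡⟨ cong (λ a → decode c l + single i a l) xᵢ≡0 ⟩
      decode c l + single i 0ℚ l         ≡⟨ cong (decode c l +_) (single-0 i l) ⟩
      decode c l + 0ℚ                    ≡⟨ +-identityʳ (decode c l) ⟩
      decode c l                         ∎

  vertex⇒∈codes₀ : ∀ k {x : Point (suc (k ℕ.+ k))} → IsVertex (Section ones) x →
                   Σ (Vec Sign (suc (k ℕ.+ k))) λ c → c ∈ codes₀ (suc (k ℕ.+ k)) k × x ≐ decode c
  vertex⇒∈codes₀ k {x} vertex@((cube , sum≡0) , _) with shape x cube
  ... | corner c z≡0 x≐ = ⊥-elim (odd-corner∉ones⊥ k c z≡0 (trans (sym (dot-cong ones x≐)) sum≡0))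
  ... | face i j i≢j xᵢ° xⱼ° = ⊥-elim (two-interior⇒¬vertex {u = ones} refl i≢j xᵢ° xⱼ° vertex)
  ... | edge c i z≡1 xᵢ° x≐ =
    let balanced , x≐c = edge∈ones⊥⇒balanced c i xᵢ° x≐ sum≡0
    in c , subst (λ j → c ∈ codes₀ _ j) (balanced⇒#P≡k {k = k} c z≡1 balanced) (∈-codes₀⁺ c z≡1) , x≐c

  ones⊥-vertices : ∀ k → HasExactlyVertices (Section (ones {suc (k ℕ.+ k)})) (length (codes₀ (suc (k ℕ.+ k)) k))
  ones⊥-vertices k =
    enumerate (Section ones) decode decode-injective (codes₀-unique _ k) (∈codes₀⇒vertex k) (λ _ → vertex⇒∈codes₀ k)

  0∷ones : Point (suc n)
  0∷ones = 0ℚ Vector.∷ ones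

  cubeVertex∉[0∷ones]⊥ : ∀ k (v : Point (suc (suc (k ℕ.+ k)))) → CubeVertex v → dot 0∷ones v ≢ 0ℚ
  cubeVertex∉[0∷ones]⊥ k v cv = cubeVertex∉ones⊥ k (tail v) (cv ∘ suc) ∘ trans (sym (dot-tail {u = 0∷ones} refl v))

  [0∷ones]⊥-vertices : ∀ k →
    HasExactlyVertices (Section (0∷ones {suc (k ℕ.+ k)})) (length (±∷ (codes₀ (suc (k ℕ.+ k)) k)))
  [0∷ones]⊥-vertices k =
    enumerate (Section 0∷ones) decode decode-injective (extend-unique (λ _ → xs) (λ _ → codes₀-unique _ k) 1) sound complete
    where
    xs = codes₀ (suc (k ℕ.+ k)) k
    sound : ∀ {c} → c ∈ ±∷ xs → IsVertex (Section 0∷ones) (decode c)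
    sound = extend-elim (λ _ → xs) (λ _ c → IsVertex (Section 0∷ones) (decode c))
      (λ c∈ → vertex-tail⁺ {u = 0∷ones} refl (inj₁ refl) (∈codes₀⇒vertex k c∈))
      (λ c∈ → vertex-tail⁺ {u = 0∷ones} refl (inj₂ refl) (∈codes₀⇒vertex k c∈)) {1}
    complete : ∀ x → IsVertex (Section 0∷ones) x → Σ (Vec Sign _) λ c → c ∈ ±∷ xs × x ≐ decode c
    complete x vertex with vertex-tail⁻ {u = 0∷ones} refl vertex
    ... | ±1x₀ , tail-vertex with vertex⇒∈codes₀ k tail-vertex | ±1x₀
    ...   | c , c∈ , tail≐ | inj₁ x₀≡1  = P ∷ c , ∈-extend-P (λ _ → xs) {0} c∈ , ≐-head-tail x₀≡1 tail≐
    ...   | c , c∈ , tail≐ | inj₂ x₀≡-1 = M ∷ c , ∈-extend-M (λ _ → xs) {1} c∈ , ≐-head-tail x₀≡-1 tail≐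

open SignVectors using (bound≡length-codes₀; bound≡length-±∷codes₀)
open CubeSections using (ones; 0∷ones; cubeVertex∉ones⊥; cubeVertex∉[0∷ones]⊥; ones⊥-vertices; [0∷ones]⊥-vertices)

open import Data.Nat using (ℕ; zero; suc; _+_; _≤_; _*_; ⌈_/2⌉; s≤s; z≤n)
open import Data.Nat.Properties using (+-suc)
open import Data.Nat.Combinatorics using (_C_)
open import Data.Rational using (0ℚ)
open import Data.Rational.Properties using (1≢0)

odd⊎even : ∀ d → 1 ≤ d → (∃ λ k → d ≡ suc (k + k)) ⊎ (∃ λ k → d ≡ suc (suc (k + k)))
odd⊎even (suc zero)    _ = inj₁ (0 , refl)
odd⊎even (suc (suc d)) _ with odd⊎even (suc d) (s≤s z≤n)
... | inj₁ (k , refl) = inj₂ (k , refl)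
... | inj₂ (k , refl) = inj₁ (suc k , cong (λ m → suc (suc m)) (sym (+-suc k k)))

theorem2p7 : (d : ℕ) → 1 ≤ d →
    Σ (Point d) λ u →
      (¬ (∀ i → u i ≡ 0ℚ)) ×
      ((v : Point d) → CubeVertex v → ¬ (dot u v ≡ 0ℚ)) ×
      HasExactlyVertices (Section u) (⌈ d /2⌉ * (d C ⌈ d /2⌉))
theorem2p7 d 1≤d with odd⊎even d 1≤d
... | inj₁ (k , refl) =
  ones , (λ ones≡0 → 1≢0 (ones≡0 zero)) , cubeVertex∉ones⊥ k ,
  subst (HasExactlyVertices (Section ones)) (sym (bound≡length-codes₀ k)) (ones⊥-vertices k)
... | inj₂ (k , refl) =
  0∷ones , (λ u≡0 → 1≢0 (u≡0 (suc zero))) , cubeVertex∉[0∷ones]⊥ k ,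
  subst (HasExactlyVertices (Section 0∷ones)) (sym (bound≡length-±∷codes₀ k)) ([0∷ones]⊥-vertices k)
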